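{- For every positive integer $k$, with $n=2k+1$, one has $\tau(n)=k+\tau(k)$.
   Context: Multi-pass stack sorting: in a pass, the entries of the current input are pushed one at a time, in order, onto a stack; whenever the top of the stack is the smallest value not yet output, it is popped to the output (repeatedly); entries are never popped otherwise. When all input entries have been pushed and no pop is possible, if the stack is nonempty the remaining entries are returned to the input in their original relative order and a new pass begins. The tier $t(\sigma)$ of a permutation $\sigma$ is one less than the minimum number of passes needed to output $1,\dots,n$. For a positive integer $n$, $\tau(n)$ denotes the maximum of $t(\sigma)$ over all permutations $\sigma$ of length $n$. -}

module Defs where

open import Data.Nat using (ℕ; zero; suc; _≡ᵇ_; _∸_; _≤_)
open import Data.Bool using (if_then_else_)
open import Data.List using (List; []; _∷_; reverse; length; map; upTo)
open import Data.Product using (_×_; _,_; Σ-syntax)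
open import Data.List.Relation.Binary.Permutation.Propositional using (_↭_)
open import Relation.Binary.PropositionalEquality using (_≡_)

-- Stacks are lists with the top element first.
-- popAll st c : repeatedly pop the top while it equals c, the smallest value
-- not yet output; returns the new stack and the new "next value to output".
popAll : List ℕ → ℕ → List ℕ × ℕ
popAll [] c = [] , c
popAll (y ∷ ys) c = if y ≡ᵇ c then popAll ys (suc c) else (y ∷ ys , c)

-- At the end the
-- remaining stack entries are returned in their original relative order
-- (bottom of stack first = reverse of the top-first list).
passAux : List ℕ → List ℕ → ℕ → List ℕ × ℕ
passAux [] st c = reverse st , c
passAux (x ∷ xs) st c with popAll (x ∷ st) c
... | st' , c' = passAux xs st' c'

pass : List ℕ → ℕ → List ℕ × ℕ
pass xs c = passAux xs [] c

-- Number of passes performed until the input becomes empty (fuel bounds the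
-- number of passes; every pass on a nonempty input outputs at least the
-- current minimum, so fuel = length of the input suffices).
passesFuel : ℕ → List ℕ → ℕ → ℕ
passesFuel _ [] c = 0
passesFuel zero (x ∷ xs) c = 0
passesFuel (suc f) (x ∷ xs) c with pass (x ∷ xs) c
... | rest , c' = suc (passesFuel f rest c')

passes : List ℕ → ℕ
passes σ = passesFuel (length σ) σ 1

tier : List ℕ → ℕ
tier σ = passes σ ∸ 1

IsPerm : ℕ → List ℕ → Set
IsPerm n σ = σ ↭ map suc (upTo n)

IsMaxTier : ℕ → ℕ → Set
IsMaxTier n m =
  (Σ[ σ ∈ List ℕ ] (IsPerm n σ × tier σ ≡ m)) ×
  (∀ σ → IsPerm n σ → tier σ ≤ m)

module Submission where

-- Write rest c for the entries of σ that are at least c, in their original order. A pass started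
-- when c is the least value not yet output, on input rest c, outputs c, …, next c − 1 and returns
-- exactly rest (next c). So the number of passes is the number of steps of next from 1 to beyond n,
-- and next is monotone, because the pass from c + 1 on rest (c + 1) runs in lockstep with the pass
-- from c and never falls behind it.
--
-- Let n = 2K + 1 and call the values above K + 1 large. If some j ≤ K is not output alone by its
-- pass, the run reaches K + 2 within K passes, after which it is the run of the pattern of the K
-- large entries, a permutation of length K. If every j ≤ K is output alone, then in rest j the small
-- entries are decreasing and j sits right after a large entry; counting large-small adjacencies
-- against the K large entries shows that K + 1 precedes all large entries, so the run takes exactly
-- K passes more than that of the pattern. The zigzag K + 1, K + 1 + π₁, K, …, K + 1 + π_K, 1 has
-- this rigid shape for any π, and attains the bound.

open import Defs
open import Data.Bool using (true; false)
open import Data.Empty using (⊥-elim)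
open import Data.Unit using (⊤; tt)
open import Data.List using (List; []; _∷_; applyUpTo; downFrom; drop; InitLast; _∷ʳ′_; initLast; _++_; [_]; _∷ʳ_; _ʳ++_; reverse; length; map; upTo; filter)
open import Data.List.Properties using (filter-++; filter-accept; map-upTo; reverse-upTo; length-map; filter-reject; filter-all; filter-none; reverse-++; reverse-map; ++-identityʳ; ++-assoc)
open import Data.List.Membership.Propositional using (_∈_; _∉_)
open import Data.List.Membership.Propositional.Properties using (∈-filter⁺; ∈-filter⁻; ∈-++⁺ʳ; ∈-++⁻; ∈-∃++)
open import Data.List.Relation.Unary.Any using (here; there)
open import Data.List.Relation.Unary.All as All using (All; []; _∷_)
import Data.List.Relation.Unary.All.Properties as All
open import Data.List.Relation.Unary.AllPairs using (AllPairs; []; _∷_)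
import Data.List.Relation.Unary.AllPairs.Properties as AllPairs
open import Data.List.Relation.Unary.Unique.Propositional using (Unique)
import Data.List.Relation.Unary.Unique.Propositional.Properties as Unique
open import Data.List.Relation.Binary.Permutation.Propositional
  using (_↭_; ↭-refl; ↭-sym; ↭-trans; ↭-prep; ↭⇒↭ₛ; module PermutationReasoning)
import Data.List.Relation.Binary.Permutation.Setoid.Properties as PermutationSetoid
open import Data.List.Relation.Binary.Permutation.Propositional.Properties
  using (shift; All-resp-↭; ∈-resp-↭; ↭-length; map⁺; ++⁺; filter-↭; ↭-reverse)
open import Data.Nat using (ℕ; zero; suc; _+_; _*_; _∸_; _≤_; _<_; _>_; _≡ᵇ_; z≤n; s≤s)
open import Data.Nat.Properties
open import Data.Product using (_×_; _,_; proj₁; proj₂; ∃₂; Σ-syntax)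
open import Data.Sum using (_⊎_; inj₁; inj₂)
import Data.Sum as Sum
open import Function using (_∘_; case_of_)
open import Level using (0ℓ)
open import Relation.Nullary using (¬_; ¬?; Dec; yes; no)
open import Relation.Nullary.Decidable using (decidable-stable)
open import Relation.Unary using (Pred; Decidable)
open import Relation.Binary.PropositionalEquality
  using (_≡_; _≢_; refl; sym; trans; cong; cong₂; subst; subst₂; setoid; module ≡-Reasoning)

module _ {A : Set} {P Q : Pred A 0ℓ} (P? : Decidable P) (Q? : Decidable Q) where

  filter-cong-∈ : ∀ xs → (∀ {z} → z ∈ xs → P z → Q z) → (∀ {z} → z ∈ xs → Q z → P z) →
                  filter P? xs ≡ filter Q? xs
  filter-cong-∈ [] _ _ = refl
  filter-cong-∈ (x ∷ xs) P⇒Q Q⇒P with P? x | Q? x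
  ... | yes _  | yes _  = cong (x ∷_) (filter-cong-∈ xs (P⇒Q ∘ there) (Q⇒P ∘ there))
  ... | no  _  | no  _  = filter-cong-∈ xs (P⇒Q ∘ there) (Q⇒P ∘ there)
  ... | yes Px | no ¬Qx = ⊥-elim (¬Qx (P⇒Q (here refl) Px))
  ... | no ¬Px | yes Qx = ⊥-elim (¬Px (Q⇒P (here refl) Qx))

  filter-absorb : (∀ {z} → Q z → P z) → ∀ xs → filter Q? (filter P? xs) ≡ filter Q? xs
  filter-absorb Q⇒P [] = refl
  filter-absorb Q⇒P (x ∷ xs) with P? x
  ... | yes _ with Q? x
  ...   | yes _ = cong (x ∷_) (filter-absorb Q⇒P xs)
  ...   | no  _ = filter-absorb Q⇒P xs
  filter-absorb Q⇒P (x ∷ xs) | no ¬Px =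
    trans (filter-absorb Q⇒P xs) (sym (filter-reject Q? (¬Px ∘ Q⇒P)))

module _ {A : Set} {P : Pred A 0ℓ} (P? : Decidable P) where

  filter-ʳ++ : ∀ xs ys → filter P? (xs ʳ++ ys) ≡ filter P? xs ʳ++ filter P? ys
  filter-ʳ++ [] ys = refl
  filter-ʳ++ (x ∷ xs) ys with P? x | filter-ʳ++ xs (x ∷ ys)
  ... | yes _ | ih = ih
  ... | no  _ | ih = ih

module _ {A : Set} where

  Unique-resp-↭ : ∀ {xs ys : List A} → xs ↭ ys → Unique xs → Unique ys
  Unique-resp-↭ p = PermutationSetoid.Unique-resp-↭ (setoid A) (↭⇒↭ₛ p)

  Unique-++⁻ˡ : ∀ xs {ys : List A} → Unique (xs ++ ys) → Unique xs
  Unique-++⁻ˡ []       _        = []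
  Unique-++⁻ˡ (x ∷ xs) (x∉ ∷ u) = All.++⁻ˡ xs x∉ ∷ Unique-++⁻ˡ xs u

  Unique-++⁻ʳ : ∀ xs {ys : List A} → Unique (xs ++ ys) → Unique ys
  Unique-++⁻ʳ []       u       = u
  Unique-++⁻ʳ (x ∷ xs) (_ ∷ u) = Unique-++⁻ʳ xs u

  Unique-++-disjoint : ∀ xs {ys : List A} {z} → Unique (xs ++ ys) → z ∈ xs → z ∉ ys
  Unique-++-disjoint (x ∷ xs) (x∉ ∷ _) (here refl)  z∈ys = All.lookup (All.++⁻ʳ xs x∉) z∈ys refl
  Unique-++-disjoint (x ∷ xs) (_ ∷ u)  (there z∈xs) z∈ys = Unique-++-disjoint xs u z∈xs z∈ys

  Unique-++-filterˡ : ∀ {P : Pred A 0ℓ} (P? : Decidable P) xs {ys} → Unique (xs ++ ys) → Unique (filter P? xs ++ ys)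
  Unique-++-filterˡ P? xs u = Unique.++⁺ (Unique.filter⁺ P? (Unique-++⁻ˡ xs u)) (Unique-++⁻ʳ xs u)
    (λ (z∈ , z∈ys) → Unique-++-disjoint xs u (proj₁ (∈-filter⁻ P? z∈)) z∈ys)

∈-∷ʳ-≢ : ∀ {A : Set} {x y : A} xs → x ∈ xs ∷ʳ y → x ≢ y → x ∈ xs
∈-∷ʳ-≢ xs x∈ x≢y with ∈-++⁻ xs x∈
... | inj₁ x∈xs       = x∈xs
... | inj₂ (here x≡y) = ⊥-elim (x≢y x≡y)

AllPairs-++⁻ : ∀ {A : Set} {R : A → A → Set} xs {ys} → AllPairs R (xs ++ ys) → ∀ {x y} → x ∈ xs → y ∈ ys → R x y
AllPairs-++⁻ (_ ∷ xs) (Rx ∷ _) (here refl)  y∈ys = All.lookup (All.++⁻ʳ xs Rx) y∈ys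
AllPairs-++⁻ (_ ∷ xs) (_ ∷ p)  (there x∈xs) y∈ys = AllPairs-++⁻ xs p x∈xs y∈ys

AllPairs-constant : ∀ {A : Set} {R : A → A → Set} {xs c} → Unique xs → All (_≡ c) xs → AllPairs R xs
AllPairs-constant []                []                 = []
AllPairs-constant (_ ∷ [])          (_ ∷ [])           = [] ∷ []
AllPairs-constant ((x≢y ∷ _) ∷ _)   (refl ∷ refl ∷ _)  = ⊥-elim (x≢y refl)

decreasing-∷ʳ : ∀ xs {y} → AllPairs _>_ xs → All (y <_) xs → AllPairs _>_ (xs ∷ʳ y)
decreasing-∷ʳ xs dec y< = AllPairs.++⁺ dec ([] ∷ []) (All.map (_∷ []) y<)

All-≤∧∉⇒< : ∀ {c} xs → All (c ≤_) xs → c ∉ xs → All (suc c ≤_) xs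
All-≤∧∉⇒< xs c≤ c∉ = All.tabulate λ z∈ → ≤∧≢⇒< (All.lookup c≤ z∈) (λ { refl → c∉ z∈ })

atLeast : ℕ → List ℕ → List ℕ
atLeast c = filter (c ≤?_)

atLeast-atLeast : ∀ {c d} → c ≤ d → ∀ xs → atLeast d (atLeast c xs) ≡ atLeast d xs
atLeast-atLeast c≤d = filter-absorb (_ ≤?_) (_ ≤?_) (≤-trans c≤d)

atLeast-raise : ∀ {b b′} → b ≤ b′ → ∀ xs → (∀ {z} → z ∈ xs → b ≤ z → b′ ≤ z) → atLeast b xs ≡ atLeast b′ xs
atLeast-raise b≤b′ xs raise = filter-cong-∈ (_ ≤?_) (_ ≤?_) xs raise (λ _ → ≤-trans b≤b′)

atLeast-skip : ∀ {c} xs → c ∉ xs → atLeast c xs ≡ atLeast (suc c) xs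
atLeast-skip xs c∉xs = atLeast-raise (n≤1+n _) xs (λ z∈xs c≤z → ≤∧≢⇒< c≤z (λ { refl → c∉xs z∈xs }))

Stuck : ℕ → List ℕ → Set
Stuck c []      = ⊤
Stuck c (y ∷ _) = y ≢ c

popAll-top≡ : ∀ c st → popAll (c ∷ st) c ≡ popAll st (suc c)
popAll-top≡ c st with c ≡ᵇ c | ≡⇒≡ᵇ c c refl
... | true | _ = refl

popAll-stuck : ∀ {c} st → Stuck c st → popAll st c ≡ (st , c)
popAll-stuck []                 _   = refl
popAll-stuck {c} (y ∷ st) y≢c with y ≡ᵇ c | ≡ᵇ⇒≡ y c
... | false | _   = refl
... | true  | y≡c = ⊥-elim (y≢c (y≡c _))

popAll-mono : ∀ st c → c ≤ proj₂ (popAll st c)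
popAll-mono []       c = ≤-refl
popAll-mono (y ∷ ys) c with y ≡ᵇ c
... | true  = ≤-trans (n≤1+n c) (popAll-mono ys (suc c))
... | false = ≤-refl

popAll-unmoved : ∀ st c → proj₂ (popAll st c) ≡ c → Stuck c st
popAll-unmoved []       c _       = tt
popAll-unmoved (y ∷ st) c unmoved refl =
  1+n≰n (subst (suc c ≤_) (trans (cong proj₂ (sym (popAll-top≡ c st))) unmoved) (popAll-mono st (suc c)))

record Pops (st : List ℕ) (c : ℕ) (st′ : List ℕ) (c′ : ℕ) : Set where
  field
    remains : st′ ≡ atLeast c′ st
    stuck   : Stuck c′ st′
    output  : ∀ {v} → c ≤ v → v < c′ → v ∈ st

popAll-spec : ∀ st c → Unique st → All (c ≤_) st → Pops st c (proj₁ (popAll st c)) (proj₂ (popAll st c))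
popAll-spec [] c _ _ = record
  { remains = refl ; stuck = tt ; output = λ c≤v v<c → ⊥-elim (<⇒≱ v<c c≤v) }
popAll-spec (y ∷ ys) c (y∉ys ∷ u) (c≤y ∷ c≤ys) with y ≟ c
... | no y≢c rewrite popAll-stuck {c} (y ∷ ys) y≢c = record
  { remains = sym (filter-all (c ≤?_) (c≤y ∷ c≤ys))
  ; stuck   = y≢c
  ; output  = λ c≤v v<c → ⊥-elim (<⇒≱ v<c c≤v) }
... | yes refl rewrite popAll-top≡ y ys = record
  { remains = trans remains (sym (filter-reject (c′ ≤?_) (<⇒≱ y<c′)))
  ; stuck   = stuck
  ; output  = output′ }
  where
  open Pops (popAll-spec ys (suc y) u (All-≤∧∉⇒< ys c≤ys (Unique.Unique[x∷xs]⇒x∉xs (y∉ys ∷ u))))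
  c′ : ℕ
  c′ = proj₂ (popAll ys (suc y))
  y<c′ : y < c′
  y<c′ = popAll-mono ys (suc y)
  output′ : ∀ {v} → y ≤ v → v < c′ → v ∈ y ∷ ys
  output′ y≤v v<c′ with m≤n⇒m<n∨m≡n y≤v
  ... | inj₁ y<v  = there (output y<v v<c′)
  ... | inj₂ refl = here refl

pops-≤ : ∀ {st c st′ c′ z} → Pops st c st′ c′ → z ∉ st → c ≤ z → c′ ≤ z
pops-≤ {c′ = c′} {z} pops z∉st c≤z with c′ ≤? z
... | yes c′≤z = c′≤z
... | no  c′≰z = ⊥-elim (z∉st (Pops.output pops c≤z (≰⇒> c′≰z)))

pops-preserve : ∀ ys {xs c st′ c′} → Unique (ys ++ xs) → All (c ≤_) (ys ++ xs) → Pops ys c st′ c′ →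
                Unique (st′ ++ xs) × All (c′ ≤_) (st′ ++ xs)
pops-preserve ys {xs} {c} {st′} {c′} u c≤ pops rewrite Pops.remains pops =
  Unique-++-filterˡ (c′ ≤?_) ys u ,
  All.++⁺ (All.all-filter (c′ ≤?_) ys)
          (All.tabulate λ z∈xs → pops-≤ pops (λ z∈ys → Unique-++-disjoint ys u z∈ys z∈xs) (All.lookup (All.++⁻ʳ ys c≤) z∈xs))

module AfterPush {x : ℕ} {st xs : List ℕ} {a : ℕ}
                 (u : Unique (st ++ x ∷ xs)) (a≤ : All (a ≤_) (st ++ x ∷ xs)) where

  st′ : List ℕ
  st′ = proj₁ (popAll (x ∷ st) a)

  a′ : ℕ
  a′ = proj₂ (popAll (x ∷ st) a)

  private
    u₀ : Unique (x ∷ st ++ xs)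
    u₀ = Unique-resp-↭ (shift x st xs) u
    a≤₀ : All (a ≤_) (x ∷ st ++ xs)
    a≤₀ = All-resp-↭ (shift x st xs) a≤

  unique-stack : Unique (x ∷ st)
  unique-stack = Unique-++⁻ˡ (x ∷ st) u₀

  disjoint : ∀ {z} → z ∈ x ∷ st → z ∉ xs
  disjoint = Unique-++-disjoint (x ∷ st) u₀

  pops : Pops (x ∷ st) a st′ a′
  pops = popAll-spec (x ∷ st) a unique-stack (All.++⁻ˡ (x ∷ st) a≤₀)

  unique′ : Unique (st′ ++ xs)
  unique′ = proj₁ (pops-preserve (x ∷ st) u₀ a≤₀ pops)

  above′ : All (a′ ≤_) (st′ ++ xs)
  above′ = proj₂ (pops-preserve (x ∷ st) u₀ a≤₀ pops)

passAux-mono : ∀ xs st c → c ≤ proj₂ (passAux xs st c)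
passAux-mono []       st c = ≤-refl
passAux-mono (x ∷ xs) st c = ≤-trans (popAll-mono (x ∷ st) c) (passAux-mono xs _ _)

-- The stack is kept top first, so st ʳ++ xs is what the pass would return if it ended now.
passAux-spec : ∀ xs st c → Unique (st ++ xs) → All (c ≤_) (st ++ xs) →
               proj₁ (passAux xs st c) ≡ atLeast (proj₂ (passAux xs st c)) (st ʳ++ xs)
passAux-spec [] st c _ c≤ =
  sym (trans (filter-ʳ++ (c ≤?_) st []) (cong (_ʳ++ []) (filter-all (c ≤?_) (All.++⁻ˡ st c≤))))
passAux-spec (x ∷ xs) st c u c≤ = begin
  proj₁ (passAux xs st′ c′)                           ≡⟨ passAux-spec xs st′ c′ unique′ above′ ⟩
  atLeast c″ (st′ ʳ++ xs)                             ≡⟨ filter-ʳ++ (c″ ≤?_) st′ xs ⟩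
  atLeast c″ st′ ʳ++ atLeast c″ xs                    ≡⟨ cong (λ s → atLeast c″ s ʳ++ atLeast c″ xs) (Pops.remains pops) ⟩
  atLeast c″ (atLeast c′ (x ∷ st)) ʳ++ atLeast c″ xs  ≡⟨ cong (_ʳ++ atLeast c″ xs) (atLeast-atLeast (passAux-mono xs st′ c′) (x ∷ st)) ⟩
  atLeast c″ (x ∷ st) ʳ++ atLeast c″ xs               ≡⟨ filter-ʳ++ (c″ ≤?_) (x ∷ st) xs ⟨
  atLeast c″ (st ʳ++ x ∷ xs)                          ∎
  where
  open ≡-Reasoning
  open AfterPush u c≤ renaming (a′ to c′)
  c″ : ℕ
  c″ = proj₂ (passAux xs st′ c′)

passAux-output : ∀ xs st c → c ∈ xs → c < proj₂ (passAux xs st c)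
passAux-output (x ∷ xs) st .x (here refl) rewrite popAll-top≡ x st =
  ≤-trans (popAll-mono st (suc x)) (passAux-mono xs _ _)
passAux-output (x ∷ xs) st c (there c∈xs) with popAll (x ∷ st) c | popAll-mono (x ∷ st) c
... | st′ , c′ | c≤c′ with m≤n⇒m<n∨m≡n c≤c′
...   | inj₁ c<c′ = <-≤-trans c<c′ (passAux-mono xs st′ c′)
...   | inj₂ refl = passAux-output xs st′ c c∈xs

passAux-no-pop : ∀ u {w st c} → c ∉ u → passAux (u ++ w) st c ≡ passAux w (u ʳ++ st) c
passAux-no-pop []      _   = refl
passAux-no-pop (x ∷ u) {st = st} c∉ rewrite popAll-stuck (x ∷ st) (λ x≡c → c∉ (here (sym x≡c))) =
  passAux-no-pop u (c∉ ∘ there)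

passAux-no-output : ∀ xs st c → c ∉ xs → proj₂ (passAux xs st c) ≡ c
passAux-no-output xs st c c∉ =
  subst (λ ys → proj₂ (passAux ys st c) ≡ c) (++-identityʳ xs) (cong proj₂ (passAux-no-pop xs c∉))

pass-through : ∀ u v j → j ∉ u → proj₂ (pass (u ++ j ∷ v) j) ≡
  proj₂ (passAux v (proj₁ (popAll (reverse u) (suc j))) (proj₂ (popAll (reverse u) (suc j))))
pass-through u v j j∉u rewrite passAux-no-pop u {j ∷ v} {[]} j∉u | popAll-top≡ j (reverse u) = refl

pass-stops-after⁺ : ∀ u y v j → j ∉ u → y ≢ j → y ≢ suc j → suc j ∉ v →
                    proj₂ (pass (u ++ y ∷ j ∷ v) j) ≡ suc j
pass-stops-after⁺ u y v j j∉u y≢j y≢sj sj∉v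
  rewrite sym (++-assoc u [ y ] (j ∷ v)) | pass-through (u ∷ʳ y) v j (λ j∈ → j∉u (∈-∷ʳ-≢ u j∈ (y≢j ∘ sym)))
        | reverse-++ u [ y ] | popAll-stuck {suc j} (y ∷ reverse u) y≢sj =
  passAux-no-output v _ (suc j) sj∉v

pass-stops-after⁻ : ∀ u v j → j ∉ u → suc j ∈ u ++ j ∷ v → proj₂ (pass (u ++ j ∷ v) j) ≡ suc j →
                    ∃₂ λ u′ y → u ≡ u′ ∷ʳ y × suc j ∈ u′
pass-stops-after⁻ u v j j∉u sj∈ stops = split (initLast u) sj∈u stuck
  where
  st₁ : List ℕ
  st₁ = proj₁ (popAll (reverse u) (suc j))
  c₁ : ℕ
  c₁ = proj₂ (popAll (reverse u) (suc j))
  stops′ : proj₂ (passAux v st₁ c₁) ≡ suc j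
  stops′ = trans (sym (pass-through u v j j∉u)) stops
  c₁≡ : c₁ ≡ suc j
  c₁≡ = ≤-antisym (subst (c₁ ≤_) stops′ (passAux-mono v st₁ c₁)) (popAll-mono (reverse u) (suc j))
  stuck : Stuck (suc j) (reverse u)
  stuck = popAll-unmoved (reverse u) (suc j) c₁≡
  sj∈u : suc j ∈ u
  sj∈u with ∈-++⁻ u sj∈
  ... | inj₁ sj∈u         = sj∈u
  ... | inj₂ (here sj≡j)  = ⊥-elim (1+n≢n sj≡j)
  ... | inj₂ (there sj∈v) = ⊥-elim (<-irrefl (trans c₁≡ (sym stops′))
                              (passAux-output v st₁ c₁ (subst (_∈ v) (sym c₁≡) sj∈v)))
  split : ∀ {u} → InitLast u → suc j ∈ u → Stuck (suc j) (reverse u) → ∃₂ λ u′ y → u ≡ u′ ∷ʳ y × suc j ∈ u′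
  split (u′ ∷ʳ′ y) sj∈ stuck = u′ , y , refl , ∈-∷ʳ-≢ u′ sj∈ (subst (Stuck (suc j)) (reverse-++ u′ [ y ]) stuck ∘ sym)

popAll-lag : ∀ st a b → a ≤ b → Unique st → proj₂ (popAll st a) ≤ proj₂ (popAll (atLeast b st) b)
popAll-lag []       a b a≤b _ = a≤b
popAll-lag (y ∷ ys) a b a≤b u@(_ ∷ u′) with y ≟ a
... | no y≢a rewrite popAll-stuck {a} (y ∷ ys) y≢a = ≤-trans a≤b (popAll-mono (atLeast b (y ∷ ys)) b)
... | yes refl rewrite popAll-top≡ y ys with m≤n⇒m<n∨m≡n a≤b
...   | inj₁ y<b rewrite filter-reject (b ≤?_) {xs = ys} (<⇒≱ y<b) = popAll-lag ys (suc y) b y<b u′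
...   | inj₂ refl rewrite filter-accept (y ≤?_) {xs = ys} ≤-refl | popAll-top≡ y (atLeast y ys)
                        | atLeast-skip ys (Unique.Unique[x∷xs]⇒x∉xs u) = popAll-lag ys (suc y) (suc y) ≤-refl u′

-- The pass from b on the entries at least b runs in lockstep with the pass from a ≤ b, skipping
-- the entries below b, and its counter never falls behind.
passAux-lag : ∀ xs st stB a b → a ≤ b → stB ≡ atLeast b st → Stuck b stB →
              Unique (st ++ xs) → All (a ≤_) (st ++ xs) →
              proj₂ (passAux xs st a) ≤ proj₂ (passAux (atLeast b xs) stB b)
passAux-lag []       _  _ _ _ a≤b _    _     _ _  = a≤b
passAux-lag (x ∷ xs) st _ a b a≤b refl stuck u a≤ with b ≤? x
... | yes b≤x rewrite filter-accept (b ≤?_) {xs = xs} b≤x =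
  subst (λ ys → proj₂ (passAux xs st′ a′) ≤ proj₂ (passAux ys stB′ b′)) (sym (atLeast-raise b≤b′ xs raise))
        (passAux-lag xs st′ stB′ a′ b′ a′≤b′ stB′≡ (Pops.stuck popsB) unique′ above′)
  where
  open ≡-Reasoning
  open AfterPush u a≤
  stB′ : List ℕ
  stB′ = proj₁ (popAll (x ∷ atLeast b st) b)
  b′ : ℕ
  b′ = proj₂ (popAll (x ∷ atLeast b st) b)
  accept : atLeast b (x ∷ st) ≡ x ∷ atLeast b st
  accept = filter-accept (b ≤?_) b≤x
  popsB : Pops (x ∷ atLeast b st) b stB′ b′
  popsB = popAll-spec (x ∷ atLeast b st) b
    (subst Unique accept (Unique.filter⁺ (b ≤?_) unique-stack)) (b≤x ∷ All.all-filter (b ≤?_) st)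
  b≤b′ : b ≤ b′
  b≤b′ = popAll-mono (x ∷ atLeast b st) b
  a′≤b′ : a′ ≤ b′
  a′≤b′ = subst (λ s → a′ ≤ proj₂ (popAll s b)) accept (popAll-lag (x ∷ st) a b a≤b unique-stack)
  stB′≡ : stB′ ≡ atLeast b′ st′
  stB′≡ = begin
    stB′                             ≡⟨ Pops.remains popsB ⟩
    atLeast b′ (x ∷ atLeast b st)    ≡⟨ cong (atLeast b′) accept ⟨
    atLeast b′ (atLeast b (x ∷ st))  ≡⟨ atLeast-atLeast b≤b′ (x ∷ st) ⟩
    atLeast b′ (x ∷ st)              ≡⟨ atLeast-atLeast a′≤b′ (x ∷ st) ⟨
    atLeast b′ (atLeast a′ (x ∷ st)) ≡⟨ cong (atLeast b′) (Pops.remains pops) ⟨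
    atLeast b′ st′                   ∎
  raise : ∀ {z} → z ∈ xs → b ≤ z → b′ ≤ z
  raise z∈xs = pops-≤ popsB λ where
    (here z≡x) → disjoint (here z≡x) z∈xs
    (there z∈) → disjoint (there (proj₁ (∈-filter⁻ (b ≤?_) z∈))) z∈xs
... | no b≰x rewrite filter-reject (b ≤?_) {xs = xs} b≰x =
  passAux-lag xs st′ (atLeast b st) a′ b a′≤b stB≡ stuck unique′ above′
  where
  open ≡-Reasoning
  open AfterPush u a≤
  reject : atLeast b (x ∷ st) ≡ atLeast b st
  reject = filter-reject (b ≤?_) b≰x
  a′≤b : a′ ≤ b
  a′≤b = subst (a′ ≤_) (cong proj₂ (trans (cong (λ s → popAll s b) reject) (popAll-stuck (atLeast b st) stuck)))
           (popAll-lag (x ∷ st) a b a≤b unique-stack)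
  stB≡ : atLeast b st ≡ atLeast b st′
  stB≡ = begin
    atLeast b st                    ≡⟨ reject ⟨
    atLeast b (x ∷ st)              ≡⟨ atLeast-atLeast a′≤b (x ∷ st) ⟨
    atLeast b (atLeast a′ (x ∷ st)) ≡⟨ cong (atLeast b) (Pops.remains pops) ⟨
    atLeast b st′                   ∎

passesFuel-suc : ∀ f w c → w ≢ [] → passesFuel (suc f) w c ≡ suc (passesFuel f (proj₁ (pass w c)) (proj₂ (pass w c)))
passesFuel-suc f []      c w≢[] = ⊥-elim (w≢[] refl)
passesFuel-suc f (_ ∷ _) c _    = refl

≡ᵇ-+ : ∀ d m n → (d + m ≡ᵇ d + n) ≡ (m ≡ᵇ n)
≡ᵇ-+ zero    m n = refl
≡ᵇ-+ (suc d) m n = ≡ᵇ-+ d m n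

popAll-shift : ∀ d st c → popAll (map (d +_) st) (d + c) ≡ (map (d +_) (proj₁ (popAll st c)) , d + proj₂ (popAll st c))
popAll-shift d []       c = refl
popAll-shift d (y ∷ ys) c rewrite ≡ᵇ-+ d y c with y ≡ᵇ c
... | true rewrite sym (+-suc d c) = popAll-shift d ys (suc c)
... | false = refl

passAux-shift : ∀ d xs st c → passAux (map (d +_) xs) (map (d +_) st) (d + c) ≡
                (map (d +_) (proj₁ (passAux xs st c)) , d + proj₂ (passAux xs st c))
passAux-shift d []       st c = cong (_, d + c) (sym (reverse-map (d +_) st))
passAux-shift d (x ∷ xs) st c rewrite popAll-shift d (x ∷ st) c = passAux-shift d xs _ _

passesFuel-shift : ∀ d f w c → passesFuel f (map (d +_) w) (d + c) ≡ passesFuel f w c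
passesFuel-shift d f       []       c = refl
passesFuel-shift d zero    (x ∷ xs) c = refl
passesFuel-shift d (suc f) (x ∷ xs) c rewrite passAux-shift d (x ∷ xs) [] c = cong suc (passesFuel-shift d f _ _)

-- Small and large entries

below : ℕ → List ℕ → List ℕ
below b = filter (_<? b)

crossing : ℕ → ℕ → ℕ → ℕ
crossing b x y with b ≤? x | y <? b
... | yes _ | yes _ = 1
... | yes _ | no  _ = 0
... | no  _ | _     = 0

crossing≤1 : ∀ b x y → crossing b x y ≤ 1
crossing≤1 b x y with b ≤? x | y <? b
... | yes _ | yes _ = ≤-refl
... | yes _ | no  _ = z≤n
... | no  _ | _     = z≤n

crossing-large : ∀ b x y → b ≤ y → crossing b x y ≡ 0
crossing-large b x y b≤y with b ≤? x | y <? b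
... | yes _ | yes y<b = ⊥-elim (<⇒≱ y<b b≤y)
... | yes _ | no  _   = refl
... | no  _ | _       = refl

crossing-small : ∀ b x y → x < b → crossing b x y ≡ 0
crossing-small b x y x<b with b ≤? x | y <? b
... | yes b≤x | _ = ⊥-elim (<⇒≱ x<b b≤x)
... | no  _   | _ = refl

crossing-large-small : ∀ b x y → b ≤ x → y < b → crossing b x y ≡ 1
crossing-large-small b x y b≤x y<b with b ≤? x | y <? b
... | yes _ | yes _   = refl
... | yes _ | no y≮b  = ⊥-elim (y≮b y<b)
... | no b≰x | _      = ⊥-elim (b≰x b≤x)

largeSmall : ℕ → List ℕ → ℕ
largeSmall b []          = 0
largeSmall b (x ∷ [])    = 0
largeSmall b (x ∷ y ∷ r) = crossing b x y + largeSmall b (y ∷ r)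

largeSmall-++ : ∀ b xs y zs → largeSmall b (xs ++ y ∷ zs) ≡ largeSmall b (xs ∷ʳ y) + largeSmall b (y ∷ zs)
largeSmall-++ b []            y zs = refl
largeSmall-++ b (x ∷ [])      y zs = cong (_+ largeSmall b (y ∷ zs)) (sym (+-identityʳ (crossing b x y)))
largeSmall-++ b (x ∷ x′ ∷ xs) y zs =
  trans (cong (crossing b x x′ +_) (largeSmall-++ b (x′ ∷ xs) y zs)) (sym (+-assoc (crossing b x x′) _ _))

largeSmall-large : ∀ b y zs → All (b ≤_) zs → largeSmall b (y ∷ zs) ≡ 0
largeSmall-large b y []       _            = refl
largeSmall-large b y (z ∷ zs) (b≤z ∷ b≤zs) =
  cong₂ _+_ (crossing-large b y z b≤z) (largeSmall-large b z zs b≤zs)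

largeSmall≤ : ∀ b w → largeSmall b w ≤ length (atLeast b w)
largeSmall≤ b []          = z≤n
largeSmall≤ b (x ∷ [])    = z≤n
largeSmall≤ b (x ∷ y ∷ r) = go (b ≤? x) (largeSmall≤ b (y ∷ r))
  where
  go : Dec (b ≤ x) → largeSmall b (y ∷ r) ≤ length (atLeast b (y ∷ r)) →
       crossing b x y + largeSmall b (y ∷ r) ≤ length (atLeast b (x ∷ y ∷ r))
  go (yes b≤x) ih rewrite filter-accept (b ≤?_) {xs = y ∷ r} b≤x = +-mono-≤ (crossing≤1 b x y) ih
  go (no b≰x)  ih rewrite filter-reject (b ≤?_) {xs = y ∷ r} b≰x | crossing-small b x y (≰⇒> b≰x) = ih

largeSmall-head : ∀ b {x y} r → b ≤ x → y < b → 1 ≤ largeSmall b (x ∷ y ∷ r)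
largeSmall-head b {x} {y} r b≤x y<b =
  subst (λ k → 1 ≤ k + largeSmall b (y ∷ r)) (sym (crossing-large-small b x y b≤x y<b)) (s≤s z≤n)

largeSmall-somewhere : ∀ b {x z} r → b ≤ x → z ∈ r → z < b → 1 ≤ largeSmall b (x ∷ r)
largeSmall-somewhere b (y ∷ r) b≤x (here refl) y<b = largeSmall-head b r b≤x y<b
largeSmall-somewhere b {x} (y ∷ r) b≤x (there z∈r) z<b = go (y <? b)
  where
  go : Dec (y < b) → 1 ≤ largeSmall b (x ∷ y ∷ r)
  go (yes y<b) = largeSmall-head b r b≤x y<b
  go (no  y≮b) = ≤-trans (largeSmall-somewhere b r (≮⇒≥ y≮b) z∈r z<b) (m≤n+m _ (crossing b x y))

below-large : ∀ {b} xs → All (b ≤_) xs → below b xs ≡ []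
below-large xs b≤ = filter-none (_<? _) (All.map (λ b≤z z<b → <⇒≱ z<b b≤z) b≤)

below-after : ∀ {b m z} xs ys → AllPairs _>_ (below b (xs ++ ys)) → m ∈ xs → m < b → z ∈ ys → m ≤ z → b ≤ z
below-after {b} xs ys dec m∈xs m<b z∈ys m≤z with b ≤? _
... | yes b≤z = b≤z
... | no  b≰z = ⊥-elim (<⇒≱ (AllPairs-++⁻ (below b xs) (subst (AllPairs _>_) (filter-++ (_<? b) xs ys) dec)
                  (∈-filter⁺ (_<? b) m∈xs m<b) (∈-filter⁺ (_<? b) z∈ys (≰⇒> b≰z))) m≤z)

module _ {b y : ℕ} (b≤y : b ≤ y) {v : List ℕ} (large : All (b ≤_) v) where

  below-skip : ∀ u → below b (u ++ y ∷ v) ≡ below b u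
  below-skip u = begin
    below b (u ++ y ∷ v)         ≡⟨ filter-++ (_<? b) u (y ∷ v) ⟩
    below b u ++ below b (y ∷ v) ≡⟨ cong (below b u ++_) (below-large (y ∷ v) (b≤y ∷ large)) ⟩
    below b u ++ []              ≡⟨ ++-identityʳ _ ⟩
    below b u                    ∎
    where open ≡-Reasoning

  below-insert : ∀ u {j} → j < b → below b (u ++ y ∷ j ∷ v) ≡ below b u ∷ʳ j
  below-insert u {j} j<b = begin
    below b (u ++ y ∷ j ∷ v)         ≡⟨ filter-++ (_<? b) u (y ∷ j ∷ v) ⟩
    below b u ++ below b (y ∷ j ∷ v) ≡⟨ cong (below b u ++_) small ⟩
    below b u ∷ʳ j                   ∎
    where
    open ≡-Reasoning
    small : below b (y ∷ j ∷ v) ≡ [ j ]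
    small = trans (filter-reject (_<? b) (λ y<b → <⇒≱ y<b b≤y))
                  (trans (filter-accept (_<? b) j<b) (cong (j ∷_) (below-large v large)))

  largeSmall-insert : ∀ u {j} → j < b → largeSmall b (u ++ y ∷ j ∷ v) ≡ suc (largeSmall b (u ++ y ∷ v))
  largeSmall-insert u {j} j<b = begin
    largeSmall b (u ++ y ∷ j ∷ v)                                 ≡⟨ largeSmall-++ b u y (j ∷ v) ⟩
    largeSmall b (u ∷ʳ y) + (crossing b y j + largeSmall b (j ∷ v)) ≡⟨ cong₂ (λ p q → largeSmall b (u ∷ʳ y) + (p + q))
                                                                        (crossing-large-small b y j b≤y j<b) (largeSmall-large b j v large) ⟩
    largeSmall b (u ∷ʳ y) + 1                                     ≡⟨ +-comm _ 1 ⟩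
    suc (largeSmall b (u ∷ʳ y))                                   ≡⟨ cong suc (+-identityʳ _) ⟨
    suc (largeSmall b (u ∷ʳ y) + 0)                               ≡⟨ cong (λ k → suc (largeSmall b (u ∷ʳ y) + k)) (largeSmall-large b y v large) ⟨
    suc (largeSmall b (u ∷ʳ y) + largeSmall b (y ∷ v))            ≡⟨ cong suc (largeSmall-++ b u y v) ⟨
    suc (largeSmall b (u ++ y ∷ v))                               ∎
    where open ≡-Reasoning

range : ℕ → ℕ → List ℕ
range k zero    = []
range k (suc m) = k ∷ range (suc k) m

upTo≡range : ∀ n → map suc (upTo n) ≡ range 1 n
upTo≡range n = trans (map-upTo suc n) (go suc 1 n (λ _ → refl))
  where
  go : ∀ f k m → (∀ i → f i ≡ k + i) → applyUpTo f m ≡ range k m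
  go f k zero    _    = refl
  go f k (suc m) f≡ = cong₂ _∷_ (trans (f≡ 0) (+-identityʳ k)) (go (f ∘ suc) (suc k) m (λ i → trans (f≡ (suc i)) (+-suc k i)))

∈-range⁻ : ∀ {x} k m → x ∈ range k m → k ≤ x × x < k + m
∈-range⁻ k (suc m) (here refl) = ≤-refl , m<m+n k (s≤s z≤n)
∈-range⁻ {x} k (suc m) (there x∈) =
  let k<x , x< = ∈-range⁻ (suc k) m x∈ in <⇒≤ k<x , subst (x <_) (sym (+-suc k m)) x<

∈-range⁺ : ∀ {x} k m → k ≤ x → x < k + m → x ∈ range k m
∈-range⁺ k zero    k≤x x< = ⊥-elim (<⇒≱ x< (subst (_≤ _) (sym (+-identityʳ k)) k≤x))
∈-range⁺ {x} k (suc m) k≤x x< with m≤n⇒m<n∨m≡n k≤x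
... | inj₂ refl = here refl
... | inj₁ k<x  = there (∈-range⁺ (suc k) m k<x (subst (x <_) (+-suc k m) x<))

unique-range : ∀ k m → Unique (range k m)
unique-range k zero    = []
unique-range k (suc m) = All.tabulate (λ x∈ → <⇒≢ (proj₁ (∈-range⁻ (suc k) m x∈))) ∷ unique-range (suc k) m

length-range : ∀ k m → length (range k m) ≡ m
length-range k zero    = refl
length-range k (suc m) = cong suc (length-range (suc k) m)

range-++ : ∀ k a b → range k (a + b) ≡ range k a ++ range (a + k) b
range-++ k zero    b = refl
range-++ k (suc a) b =
  cong (k ∷_) (trans (range-++ (suc k) a b) (cong (λ c → range (suc k) a ++ range c b) (+-suc a k)))

map-+-range : ∀ d k m → map (d +_) (range k m) ≡ range (d + k) m
map-+-range d k zero    = refl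
map-+-range d k (suc m) = cong (d + k ∷_) (trans (map-+-range d (suc k) m) (cong (λ c → range c m) (+-suc d k)))

map-∸-range : ∀ d k m → map (_∸ d) (range (d + k) m) ≡ range k m
map-∸-range d k zero    = refl
map-∸-range d k (suc m) = cong₂ _∷_ (m+n∸m≡n d k)
  (trans (cong (λ c → map (_∸ d) (range c m)) (sym (+-suc d k))) (map-∸-range d (suc k) m))

map-∸-+ : ∀ d xs → map (_∸ d) (map (d +_) xs) ≡ xs
map-∸-+ d []       = refl
map-∸-+ d (x ∷ xs) = cong₂ _∷_ (m+n∸m≡n d x) (map-∸-+ d xs)

map-+-∸ : ∀ {d} xs → All (d ≤_) xs → map (d +_) (map (_∸ d) xs) ≡ xs
map-+-∸ []       []           = refl
map-+-∸ (x ∷ xs) (d≤x ∷ d≤xs) = cong₂ _∷_ (m+[n∸m]≡n d≤x) (map-+-∸ xs d≤xs)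

IsPerm⇒↭range : ∀ {n σ} → IsPerm n σ → σ ↭ range 1 n
IsPerm⇒↭range {n} {σ} = subst (σ ↭_) (upTo≡range n)

IsPerm⇒length : ∀ {n σ} → IsPerm n σ → length σ ≡ n
IsPerm⇒length σ↭ = trans (↭-length (IsPerm⇒↭range σ↭)) (length-range 1 _)

record PermOf (n : ℕ) (σ : List ℕ) : Set where
  field
    unique   : Unique σ
    positive : All (1 ≤_) σ
    bounded  : All (_≤ n) σ
    complete : ∀ {x} → 1 ≤ x → x ≤ n → x ∈ σ

permOf : ∀ {n σ} → IsPerm n σ → PermOf n σ
permOf {n} {σ} σ↭ = record
  { unique   = Unique-resp-↭ range↭σ (unique-range 1 n)
  ; positive = All-resp-↭ range↭σ (All.tabulate λ x∈ → proj₁ (∈-range⁻ 1 n x∈))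
  ; bounded  = All-resp-↭ range↭σ (All.tabulate λ x∈ → ≤-pred (proj₂ (∈-range⁻ 1 n x∈)))
  ; complete = λ 1≤x x≤n → ∈-resp-↭ range↭σ (∈-range⁺ 1 n 1≤x (s≤s x≤n)) }
  where
  range↭σ : range 1 n ↭ σ
  range↭σ = ↭-sym (IsPerm⇒↭range σ↭)

module Passes {n σ} (perm : PermOf n σ) where
  open PermOf perm

  rest : ℕ → List ℕ
  rest c = atLeast c σ

  next : ℕ → ℕ
  next c = proj₂ (pass (rest c) c)

  unique-rest : ∀ c → Unique (rest c)
  unique-rest c = Unique.filter⁺ (c ≤?_) unique

  above-rest : ∀ c → All (c ≤_) (rest c)
  above-rest c = All.all-filter (c ≤?_) σ

  ≤next : ∀ c → c ≤ next c
  ≤next c = passAux-mono (rest c) [] c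

  pass-rest : ∀ c → pass (rest c) c ≡ (rest (next c) , next c)
  pass-rest c = cong (_, next c)
    (trans (passAux-spec (rest c) [] c (unique-rest c) (above-rest c)) (atLeast-atLeast (≤next c) σ))

  ∈rest : ∀ {c} → 1 ≤ c → c ≤ n → c ∈ rest c
  ∈rest 1≤c c≤n = ∈-filter⁺ (_ ≤?_) (complete 1≤c c≤n) ≤-refl

  <next : ∀ {c} → 1 ≤ c → c ≤ n → c < next c
  <next {c} 1≤c c≤n = passAux-output (rest c) [] c (∈rest 1≤c c≤n)

  next-mono : ∀ c → next c ≤ next (suc c)
  next-mono c = subst (λ ys → next c ≤ proj₂ (passAux ys [] (suc c))) (atLeast-atLeast (n≤1+n c) σ)
    (passAux-lag (rest c) [] [] c (suc c) (n≤1+n c) refl tt (unique-rest c) (above-rest c))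

  rest-done : ∀ {c} → n < c → rest c ≡ []
  rest-done {c} n<c = filter-none (c ≤?_) (All.map (λ x≤n → <⇒≱ (≤-<-trans x≤n n<c)) bounded)

  passesWith : ℕ → ℕ → ℕ
  passesWith f c = passesFuel f (rest c) c

  passesWith-suc : ∀ f {c} → 1 ≤ c → c ≤ n → passesWith (suc f) c ≡ suc (passesWith f (next c))
  passesWith-suc f {c} 1≤c c≤n =
    trans (passesFuel-suc f (rest c) c (λ rest≡[] → case subst (c ∈_) rest≡[] (∈rest 1≤c c≤n) of λ ()))
          (cong (λ r → suc (passesFuel f (proj₁ r) (proj₂ r))) (pass-rest c))

  passesWith-done : ∀ f {c} → n < c → passesWith f c ≡ 0
  passesWith-done f n<c rewrite rest-done n<c = refl

  passesWith-fuel : ∀ f f′ {c} → 1 ≤ c → suc n ∸ c ≤ f → suc n ∸ c ≤ f′ → passesWith f c ≡ passesWith f′ c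
  passesWith-fuel f f′ {c} 1≤c enough enough′ with n <? c
  ... | yes n<c = trans (passesWith-done f n<c) (sym (passesWith-done f′ n<c))
  ... | no n≮c with f | f′
  ...   | zero  | _      = ⊥-elim (n≮c (m∸n≡0⇒m≤n (n≤0⇒n≡0 enough)))
  ...   | suc _ | zero   = ⊥-elim (n≮c (m∸n≡0⇒m≤n (n≤0⇒n≡0 enough′)))
  ...   | suc g | suc g′ = begin
    passesWith (suc g) c       ≡⟨ passesWith-suc g 1≤c c≤n ⟩
    suc (passesWith g (next c))  ≡⟨ cong suc (passesWith-fuel g g′ (≤-trans 1≤c (≤next c)) (less enough) (less enough′)) ⟩
    suc (passesWith g′ (next c)) ≡⟨ passesWith-suc g′ 1≤c c≤n ⟨
    passesWith (suc g′) c      ∎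
    where
    open ≡-Reasoning
    c≤n : c ≤ n
    c≤n = ≮⇒≥ n≮c
    less : ∀ {h} → suc n ∸ c ≤ suc h → suc n ∸ next c ≤ h
    less {h} enough = ≤-trans (∸-monoʳ-≤ (suc n) (<next 1≤c c≤n))
                        (≤-pred (subst (_≤ suc h) (+-∸-assoc 1 c≤n) enough))

  passesFrom : ℕ → ℕ
  passesFrom = passesWith (suc n)

  passesFrom-done : ∀ {c} → n < c → passesFrom c ≡ 0
  passesFrom-done = passesWith-done (suc n)

  passesFrom-suc : ∀ {c} → 1 ≤ c → c ≤ n → passesFrom c ≡ suc (passesFrom (next c))
  passesFrom-suc {c} 1≤c c≤n = trans (passesWith-suc n 1≤c c≤n)
    (cong suc (passesWith-fuel n (suc n) 1≤next (∸-monoʳ-≤ (suc n) 1≤next) (m∸n≤m (suc n) (next c))))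
    where
    1≤next : 1 ≤ next c
    1≤next = ≤-trans 1≤c (≤next c)

  passesFrom-anti : ∀ {c d} → 1 ≤ c → c ≤ d → passesFrom d ≤ passesFrom c
  passesFrom-anti {c} 1≤c = go (suc n ∸ c) 1≤c ≤-refl
    where
    go : ∀ m {c d} → 1 ≤ c → suc n ∸ c ≤ m → c ≤ d → passesFrom d ≤ passesFrom c
    go m {c} {d} 1≤c bound c≤d with n <? c
    ... | yes n<c = ≤-reflexive (trans (passesFrom-done (<-≤-trans n<c c≤d)) (sym (passesFrom-done n<c)))
    ... | no n≮c with m≤n⇒m<n∨m≡n c≤d | m
    ...   | inj₂ refl | _      = ≤-refl
    ...   | inj₁ _    | zero   = ⊥-elim (n≮c (m∸n≡0⇒m≤n (n≤0⇒n≡0 bound)))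
    ...   | inj₁ c<d  | suc m′ = ≤-trans (go m′ (s≤s z≤n) bound′ c<d) adjacent
      where
      c≤n : c ≤ n
      c≤n = ≮⇒≥ n≮c
      bound′ : suc n ∸ suc c ≤ m′
      bound′ = ≤-pred (subst (_≤ suc m′) (+-∸-assoc 1 c≤n) bound)
      adjacent : passesFrom (suc c) ≤ passesFrom c
      adjacent with n <? suc c
      ... | yes n<sc = subst (_≤ passesFrom c) (sym (passesFrom-done n<sc)) z≤n
      ... | no n≮sc = subst₂ _≤_ (sym (passesFrom-suc (s≤s z≤n) (≮⇒≥ n≮sc))) (sym (passesFrom-suc 1≤c c≤n))
                        (s≤s (go m′ (≤-trans 1≤c (≤next c))
                          (≤-trans (∸-monoʳ-≤ (suc n) (<next 1≤c c≤n)) bound′) (next-mono c)))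

  passesFrom-step : ∀ {c} → 1 ≤ c → passesFrom c ≤ suc (passesFrom (suc c))
  passesFrom-step {c} 1≤c with n <? c
  ... | yes n<c = subst (_≤ suc (passesFrom (suc c))) (sym (passesFrom-done n<c)) z≤n
  ... | no  n≮c = subst (_≤ suc (passesFrom (suc c))) (sym (passesFrom-suc 1≤c (≮⇒≥ n≮c)))
                    (s≤s (passesFrom-anti (s≤s z≤n) (<next 1≤c (≮⇒≥ n≮c))))

  passesFrom-iter : ∀ t {c} → 1 ≤ c → passesFrom c ≤ t + passesFrom (t + c)
  passesFrom-iter zero    1≤c = ≤-refl
  passesFrom-iter (suc t) {c} 1≤c = ≤-trans (passesFrom-iter t 1≤c)
    (subst (t + passesFrom (t + c) ≤_) (+-suc t _) (+-monoʳ-≤ t (passesFrom-step (≤-trans 1≤c (m≤n+m c t)))))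

  passesFrom-rigid : ∀ t {c} → 1 ≤ c → c + t ≤ suc n → (∀ {j} → c ≤ j → j < c + t → next j ≡ suc j) →
                     passesFrom c ≡ t + passesFrom (t + c)
  passesFrom-rigid zero    _ _ _ = refl
  passesFrom-rigid (suc t) {c} 1≤c bound rigid = begin
    passesFrom c                     ≡⟨ passesFrom-suc 1≤c c≤n ⟩
    suc (passesFrom (next c))        ≡⟨ cong (suc ∘ passesFrom) (rigid ≤-refl c<c+st) ⟩
    suc (passesFrom (suc c))         ≡⟨ cong suc (passesFrom-rigid t (s≤s z≤n) bound′ rigid′) ⟩
    suc (t + passesFrom (t + suc c)) ≡⟨ cong (λ d → suc (t + passesFrom d)) (+-suc t c) ⟩
    suc t + passesFrom (suc t + c)   ∎
    where
    open ≡-Reasoning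
    c<c+st : c < c + suc t
    c<c+st = m<m+n c (s≤s z≤n)
    c≤n : c ≤ n
    c≤n = ≤-pred (≤-trans c<c+st bound)
    bound′ : suc c + t ≤ suc n
    bound′ = subst (_≤ suc n) (+-suc c t) bound
    rigid′ : ∀ {j} → suc c ≤ j → j < suc c + t → next j ≡ suc j
    rigid′ {j} c<j j< = rigid (<⇒≤ c<j) (subst (j <_) (sym (+-suc c t)) j<)

-- Permutations of length 2K + 1

-- The values 1, …, K + 1 are small and B, …, 2K + 1 are large.
module OddLength {K σ} (1≤K : 1 ≤ K) (perm : PermOf (suc (K + K)) σ) where
  open PermOf perm
  open Passes perm public

  B : ℕ
  B = suc (suc K)

  B≤n : B ≤ suc (K + K)
  B≤n = s≤s (subst (_≤ K + K) (+-comm K 1) (+-monoʳ-≤ K 1≤K))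

  K≤n : K ≤ suc (K + K)
  K≤n = ≤-trans (m≤m+n K K) (n≤1+n _)

  Rigid : ℕ → Set
  Rigid j = next j ≡ suc j

  record Shape (j : ℕ) : Set where
    field
      u         : List ℕ
      y         : ℕ
      v         : List ℕ
      rest≡     : rest j ≡ u ++ y ∷ j ∷ v
      rest-suc≡ : rest (suc j) ≡ u ++ y ∷ v
      suc∈u     : suc j ∈ u

  rigid-shape : ∀ {j} → 1 ≤ j → j ≤ K → Rigid j → Shape j
  rigid-shape {j} 1≤j j≤K rigid = shape (∈-∃++ (∈rest 1≤j (≤-trans j≤K K≤n)))
    where
    shape : (∃₂ λ u₀ v → rest j ≡ u₀ ++ j ∷ v) → Shape j
    shape (u₀ , v , rest≡₀) = build (pass-stops-after⁻ u₀ v j j∉u₀ suc-j∈ stops)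
      where
      open ≡-Reasoning
      unique₀ : Unique (u₀ ++ j ∷ v)
      unique₀ = subst Unique rest≡₀ (unique-rest j)
      j∉u₀ : j ∉ u₀
      j∉u₀ j∈u₀ = Unique-++-disjoint u₀ unique₀ j∈u₀ (here refl)
      j∉v : j ∉ v
      j∉v = Unique.Unique[x∷xs]⇒x∉xs (Unique-++⁻ʳ u₀ unique₀)
      j≤ : All (j ≤_) (u₀ ++ j ∷ v)
      j≤ = subst (All (j ≤_)) rest≡₀ (above-rest j)
      suc-j∈ : suc j ∈ u₀ ++ j ∷ v
      suc-j∈ = subst (suc j ∈_) rest≡₀
        (∈-filter⁺ (j ≤?_) (complete (s≤s z≤n) (s≤s (≤-trans j≤K (m≤m+n K K)))) (n≤1+n j))
      stops : proj₂ (pass (u₀ ++ j ∷ v) j) ≡ suc j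
      stops = subst (λ w → proj₂ (pass w j) ≡ suc j) rest≡₀ rigid
      rest-suc≡₀ : rest (suc j) ≡ u₀ ++ v
      rest-suc≡₀ = begin
        rest (suc j)                                  ≡⟨ atLeast-atLeast (n≤1+n j) σ ⟨
        atLeast (suc j) (rest j)                      ≡⟨ cong (atLeast (suc j)) rest≡₀ ⟩
        atLeast (suc j) (u₀ ++ j ∷ v)                 ≡⟨ filter-++ (suc j ≤?_) u₀ (j ∷ v) ⟩
        atLeast (suc j) u₀ ++ atLeast (suc j) (j ∷ v) ≡⟨ cong₂ _++_
            (filter-all (suc j ≤?_) (All-≤∧∉⇒< u₀ (All.++⁻ˡ u₀ j≤) j∉u₀))
            (trans (filter-reject (suc j ≤?_) 1+n≰n)
                   (filter-all (suc j ≤?_) (All-≤∧∉⇒< v (All.tail (All.++⁻ʳ u₀ j≤)) j∉v))) ⟩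
        u₀ ++ v                                       ∎
      build : (∃₂ λ u y → u₀ ≡ u ∷ʳ y × suc j ∈ u) → Shape j
      build (u , y , u₀≡ , suc∈u) = record
        { u = u ; y = y ; v = v
        ; rest≡     = trans rest≡₀ (trans (cong (_++ j ∷ v) u₀≡) (++-assoc u [ y ] (j ∷ v)))
        ; rest-suc≡ = trans rest-suc≡₀ (trans (cong (_++ v) u₀≡) (++-assoc u [ y ] v))
        ; suc∈u     = suc∈u }

  -- As j + 1 ∈ u is the least small entry of rest (j + 1), whose small entries are decreasing,
  -- every entry after it is large: y and all of v.
  rigid-step : ∀ {j} → 1 ≤ j → j ≤ K → Rigid j → AllPairs _>_ (below B (rest (suc j))) →
               AllPairs _>_ (below B (rest j)) × largeSmall B (rest j) ≡ suc (largeSmall B (rest (suc j)))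
  rigid-step {j} 1≤j j≤K rigid dec =
    subst (AllPairs _>_) (sym below-j)
      (decreasing-∷ʳ (below B u) (subst (AllPairs _>_) (below-skip B≤y v-large u) dec′)
        (All.filter⁺ (_<? B) (All.++⁻ˡ u above))) ,
    trans (cong (largeSmall B) rest≡)
      (trans (largeSmall-insert B≤y v-large u j<B) (cong (suc ∘ largeSmall B) (sym rest-suc≡)))
    where
    open Shape (rigid-shape 1≤j j≤K rigid)
    j<B : j < B
    j<B = s≤s (≤-trans j≤K (n≤1+n K))
    above : All (suc j ≤_) (u ++ y ∷ v)
    above = subst (All (suc j ≤_)) rest-suc≡ (above-rest (suc j))
    dec′ : AllPairs _>_ (below B (u ++ y ∷ v))
    dec′ = subst (λ w → AllPairs _>_ (below B w)) rest-suc≡ dec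
    large : ∀ {z} → z ∈ y ∷ v → B ≤ z
    large z∈ = below-after u (y ∷ v) dec′ suc∈u (s≤s (s≤s j≤K)) z∈ (All.lookup above (∈-++⁺ʳ u z∈))
    B≤y : B ≤ y
    B≤y = large (here refl)
    v-large : All (B ≤_) v
    v-large = All.tabulate (large ∘ there)
    below-j : below B (rest j) ≡ below B u ∷ʳ j
    below-j = trans (cong (below B) rest≡) (below-insert B≤y v-large u j<B)

  AllRigid : Set
  AllRigid = ∀ {j} → 1 ≤ j → j ≤ K → Rigid j

  rigid-invariant : AllRigid → ∀ t {j} → 1 ≤ j → j + t ≡ suc K →
                    AllPairs _>_ (below B (rest j)) × largeSmall B (rest j) ≡ t + largeSmall B (rest (suc K))
  rigid-invariant rigid zero {j} _ j+0≡ with trans (sym (+-identityʳ j)) j+0≡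
  ... | refl = AllPairs-constant (Unique.filter⁺ (_<? B) (unique-rest (suc K))) (All.tabulate only-suc-K) , refl
    where
    only-suc-K : ∀ {z} → z ∈ below B (rest (suc K)) → z ≡ suc K
    only-suc-K z∈ = let z∈rest , z<B = ∈-filter⁻ (_<? B) z∈ in
      ≤-antisym (≤-pred z<B) (All.lookup (above-rest (suc K)) z∈rest)
  rigid-invariant rigid (suc t) {j} 1≤j j+t+1≡ =
    let dec , ls = rigid-invariant rigid t {suc j} (s≤s z≤n) (trans (sym (+-suc j t)) j+t+1≡)
        dec′ , ls′ = rigid-step 1≤j j≤K (rigid 1≤j j≤K) dec
    in dec′ , trans ls′ (cong suc ls)
    where
    j≤K : j ≤ K
    j≤K = ≤-pred (subst (suc j ≤_) (trans (sym (+-suc j t)) j+t+1≡) (m≤m+n (suc j) t))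

  -- Each of the K large entries of rest 1 starts at most one large-small pair.
  largeSmall-rest-suc-K : AllRigid → length (rest B) ≡ K → largeSmall B (rest (suc K)) ≡ 0
  largeSmall-rest-suc-K rigid len = n≤0⇒n≡0 (+-cancelˡ-≤ K _ 0 (begin
    K + largeSmall B (rest (suc K)) ≡⟨ proj₂ (rigid-invariant rigid K ≤-refl refl) ⟨
    largeSmall B (rest 1)          ≤⟨ largeSmall≤ B (rest 1) ⟩
    length (atLeast B (rest 1))    ≡⟨ cong length (atLeast-atLeast (s≤s z≤n) σ) ⟩
    length (rest B)                ≡⟨ len ⟩
    K                              ≡⟨ +-identityʳ K ⟨
    K + 0                          ∎))
    where open ≤-Reasoning

  rigid-rest : AllRigid → length (rest B) ≡ K → rest (suc K) ≡ suc K ∷ rest B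
  rigid-rest rigid len = split (rest (suc K)) refl
    where
    suc-K∈ : suc K ∈ rest (suc K)
    suc-K∈ = ∈rest (s≤s z≤n) (s≤s (m≤m+n K K))
    split : ∀ w → rest (suc K) ≡ w → rest (suc K) ≡ suc K ∷ rest B
    split []      eq = ⊥-elim (case subst (suc K ∈_) eq suc-K∈ of λ ())
    split (x ∷ r) eq = trans eq (cong₂ _∷_ x≡ (sym r≡))
      where
      open ≡-Reasoning
      x<B : x < B
      x<B with B ≤? x | subst (suc K ∈_) eq suc-K∈
      ... | no  B≰x | _ = ≰⇒> B≰x
      ... | yes B≤x | here refl = ⊥-elim (<⇒≱ (n<1+n (suc K)) B≤x)
      ... | yes B≤x | there suc-K∈r = ⊥-elim (<⇒≱ (largeSmall-somewhere B r B≤x suc-K∈r (n<1+n (suc K)))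
                                       (≤-reflexive (trans (cong (largeSmall B) (sym eq)) (largeSmall-rest-suc-K rigid len))))
      suc-K≤ : All (suc K ≤_) (x ∷ r)
      suc-K≤ = subst (All (suc K ≤_)) eq (above-rest (suc K))
      x≡ : x ≡ suc K
      x≡ = ≤-antisym (≤-pred x<B) (All.head suc-K≤)
      r-large : All (B ≤_) r
      r-large = All-≤∧∉⇒< r (All.tail suc-K≤)
        (subst (_∉ r) x≡ (Unique.Unique[x∷xs]⇒x∉xs (subst Unique eq (unique-rest (suc K)))))
      r≡ : rest B ≡ r
      r≡ = begin
        rest B                    ≡⟨ atLeast-atLeast (n≤1+n (suc K)) σ ⟨
        atLeast B (rest (suc K))  ≡⟨ cong (atLeast B) eq ⟩
        atLeast B (x ∷ r)         ≡⟨ filter-reject (B ≤?_) (<⇒≱ x<B) ⟩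
        atLeast B r               ≡⟨ filter-all (B ≤?_) r-large ⟩
        r                         ∎

  rigid-passes : AllRigid → rest (suc K) ≡ suc K ∷ rest B → passesFrom 1 ≡ K + passesFrom B
  rigid-passes rigid rest≡ = begin
    passesFrom 1                        ≡⟨ passesFrom-rigid K ≤-refl (s≤s K≤n) (λ 1≤j j≤K → rigid 1≤j (≤-pred j≤K)) ⟩
    K + passesFrom (K + 1)              ≡⟨ cong (λ c → K + passesFrom c) (+-comm K 1) ⟩
    K + passesFrom (suc K)              ≡⟨ cong (K +_) (passesFrom-suc (s≤s z≤n) (s≤s (m≤m+n K K))) ⟩
    K + suc (passesFrom (next (suc K))) ≡⟨ cong (λ c → K + suc (passesFrom c)) next-suc-K ⟩
    K + suc (passesFrom (next B))       ≡⟨ cong (K +_) (passesFrom-suc (s≤s z≤n) B≤n) ⟨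
    K + passesFrom B                    ∎
    where
    open ≡-Reasoning
    next-suc-K : next (suc K) ≡ next B
    next-suc-K = trans (cong (λ w → proj₂ (pass w (suc K))) rest≡)
                       (cong (λ p → proj₂ (passAux (rest B) (proj₁ p) (proj₂ p))) (popAll-top≡ (suc K) []))

  nonrigid-passes : ∀ i → suc i ≤ K → ¬ Rigid (suc i) → passesFrom 1 ≤ K + passesFrom B
  nonrigid-passes i i<K ¬rigid with m≤n⇒∃[o]m+o≡n i<K
  ... | r , i+1+r≡K = begin
    passesFrom 1                           ≤⟨ passesFrom-iter i ≤-refl ⟩
    i + passesFrom (i + 1)                 ≡⟨ cong (λ c → i + passesFrom c) (+-comm i 1) ⟩
    i + passesFrom (suc i)                 ≡⟨ cong (i +_) (passesFrom-suc (s≤s z≤n) (≤-trans i<K K≤n)) ⟩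
    i + suc (passesFrom (next (suc i)))    ≤⟨ +-monoʳ-≤ i (s≤s (passesFrom-anti (s≤s z≤n) skips)) ⟩
    i + suc (passesFrom (3 + i))           ≤⟨ +-monoʳ-≤ i (s≤s (passesFrom-iter r (s≤s z≤n))) ⟩
    i + suc (r + passesFrom (r + (3 + i))) ≡⟨ cong (λ c → i + suc (r + passesFrom c)) r+3+i≡B ⟩
    i + suc (r + passesFrom B)             ≡⟨ trans (+-suc i _) (cong suc (sym (+-assoc i r _))) ⟩
    suc i + r + passesFrom B               ≡⟨ cong (_+ passesFrom B) i+1+r≡K ⟩
    K + passesFrom B                       ∎
    where
    open ≤-Reasoning
    skips : 3 + i ≤ next (suc i)
    skips = ≤∧≢⇒< (<next (s≤s z≤n) (≤-trans i<K K≤n)) (¬rigid ∘ sym)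
    r+3+i≡B : r + (3 + i) ≡ B
    r+3+i≡B = trans (+-comm r (3 + i)) (cong (suc ∘ suc) i+1+r≡K)

  passesFrom-upper : length (rest B) ≡ K → passesFrom 1 ≤ K + passesFrom B
  passesFrom-upper len with anyUpTo? (λ i → ¬? (next (suc i) ≟ suc (suc i))) K
  ... | yes (i , i<K , ¬rigid) = nonrigid-passes i i<K ¬rigid
  ... | no  none               = ≤-reflexive (rigid-passes rigid (rigid-rest rigid len))
    where
    rigid : AllRigid
    rigid {suc i} _ i<K = decidable-stable (next (suc i) ≟ suc (suc i)) (λ ¬rigid → none (i , i<K , ¬rigid))

module Reduction {K σ} (1≤K : 1 ≤ K) (σ↭ : IsPerm (suc (K + K)) σ) where
  open OddLength 1≤K (permOf σ↭) public

  passes≡ : passes σ ≡ passesFrom 1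
  passes≡ = begin
    passesFuel (length σ) σ 1 ≡⟨ cong (λ w → passesFuel (length σ) w 1) (filter-all (1 ≤?_) (PermOf.positive (permOf σ↭))) ⟨
    passesWith (length σ) 1   ≡⟨ passesWith-fuel (length σ) _ ≤-refl (≤-reflexive (sym (IsPerm⇒length σ↭))) (n≤1+n _) ⟩
    passesFrom 1              ∎
    where open ≡-Reasoning

  rest-B↭ : rest B ↭ range (suc K + 1) K
  rest-B↭ = subst (rest B ↭_) large-part (filter-↭ (B ≤?_) (IsPerm⇒↭range σ↭))
    where
    large-part : atLeast B (range 1 (suc K + K)) ≡ range (suc K + 1) K
    large-part = trans (cong (atLeast B) (range-++ 1 (suc K) K)) (trans (filter-++ (B ≤?_) (range 1 (suc K)) _)
      (cong₂ _++_ (filter-none (B ≤?_) (All.tabulate λ x∈ → <⇒≱ (proj₂ (∈-range⁻ 1 (suc K) x∈))))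
                  (filter-all (B ≤?_) (All.tabulate λ {x} x∈ → subst (_≤ x) (+-comm (suc K) 1) (proj₁ (∈-range⁻ (suc K + 1) K x∈))))))

  length-rest-B : length (rest B) ≡ K
  length-rest-B = trans (↭-length rest-B↭) (length-range _ K)

  standardized : List ℕ
  standardized = map (_∸ suc K) (rest B)

  standardized-perm : IsPerm K standardized
  standardized-perm = subst (standardized ↭_) (trans (map-∸-range (suc K) 1 K) (sym (upTo≡range K)))
                            (map⁺ (_∸ suc K) rest-B↭)

  passesFrom-B≡ : passesFrom B ≡ passes standardized
  passesFrom-B≡ = begin
    passesWith (suc (suc (K + K))) B                           ≡⟨ passesWith-fuel _ K (s≤s z≤n) (m∸n≤m _ B) (≤-reflexive (m+n∸m≡n K K)) ⟩
    passesFuel K (rest B) B                                     ≡⟨ cong₂ (passesFuel K) rest-B≡ (+-comm 1 (suc K)) ⟩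
    passesFuel K (map (suc K +_) standardized) (suc K + 1)      ≡⟨ passesFuel-shift (suc K) K standardized 1 ⟩
    passesFuel K standardized 1                                 ≡⟨ cong (λ f → passesFuel f standardized 1) length-standardized ⟨
    passes standardized                                         ∎
    where
    open ≡-Reasoning
    rest-B≡ : rest B ≡ map (suc K +_) standardized
    rest-B≡ = sym (map-+-∸ (rest B) (All.map (≤-trans (n≤1+n _)) (above-rest B)))
    length-standardized : length standardized ≡ K
    length-standardized = trans (length-map _ (rest B)) length-rest-B

  tier-after-K : (K + passesFrom B) ∸ 1 ≡ K + tier standardized
  tier-after-K = begin
    (K + passesFrom B) ∸ 1                 ≡⟨ cong (λ p → (K + p) ∸ 1) (passesFrom-suc (s≤s z≤n) B≤n) ⟩
    (K + suc (passesFrom (next B))) ∸ 1    ≡⟨ cong (_∸ 1) (+-suc K _) ⟩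
    K + passesFrom (next B)                ≡⟨ cong (λ p → K + (p ∸ 1)) (trans (sym (passesFrom-suc (s≤s z≤n) B≤n)) passesFrom-B≡) ⟩
    K + tier standardized                  ∎
    where open ≡-Reasoning

  tier-upper : tier σ ≤ K + tier standardized
  tier-upper = begin
    passes σ ∸ 1            ≡⟨ cong (_∸ 1) passes≡ ⟩
    passesFrom 1 ∸ 1        ≤⟨ ∸-monoˡ-≤ 1 (passesFrom-upper length-rest-B) ⟩
    (K + passesFrom B) ∸ 1  ≡⟨ tier-after-K ⟩
    K + tier standardized   ∎
    where open ≤-Reasoning

  tier-rigid : AllRigid → tier σ ≡ K + tier standardized
  tier-rigid rigid = trans (cong (_∸ 1) (trans passes≡ (rigid-passes rigid (rigid-rest rigid length-rest-B)))) tier-after-K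

-- The zigzag permutation

zigzag : ℕ → List ℕ → List ℕ
zigzag d []       = [ 1 ]
zigzag d (p ∷ ps) = suc (suc (length ps)) ∷ d + p ∷ zigzag d ps

zigzag-head : ∀ d ps → zigzag d ps ≡ suc (length ps) ∷ drop 1 (zigzag d ps)
zigzag-head d []      = refl
zigzag-head d (_ ∷ _) = refl

zigzag-↭ : ∀ d ps → zigzag d ps ↭ map suc (downFrom (suc (length ps))) ++ map (d +_) ps
zigzag-↭ d []       = ↭-refl
zigzag-↭ d (p ∷ ps) = ↭-prep _ (↭-trans (↭-prep (d + p) (zigzag-↭ d ps))
  (↭-sym (shift (d + p) (map suc (downFrom (suc (length ps)))) (map (d +_) ps))))

downFrom↭range : ∀ m → map suc (downFrom m) ↭ range 1 m
downFrom↭range m = subst₂ _↭_ (cong (map suc) (reverse-upTo m)) (upTo≡range m) (map⁺ suc (↭-reverse (upTo m)))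

zigzag-perm : ∀ {K π} → IsPerm K π → IsPerm (suc (K + K)) (zigzag (suc K) π)
zigzag-perm {K} {π} π↭ = begin
  zigzag (suc K) π                                         ↭⟨ zigzag-↭ (suc K) π ⟩
  map suc (downFrom (suc (length π))) ++ map (suc K +_) π   ≡⟨ cong (λ l → map suc (downFrom (suc l)) ++ map (suc K +_) π) length-π ⟩
  map suc (downFrom (suc K)) ++ map (suc K +_) π            ↭⟨ ++⁺ (downFrom↭range (suc K)) (map⁺ (suc K +_) (IsPerm⇒↭range π↭)) ⟩
  range 1 (suc K) ++ map (suc K +_) (range 1 K)             ≡⟨ cong (range 1 (suc K) ++_) (map-+-range (suc K) 1 K) ⟩
  range 1 (suc K) ++ range (suc K + 1) K                    ≡⟨ range-++ 1 (suc K) K ⟨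
  range 1 (suc K + K)                                       ≡⟨ upTo≡range _ ⟨
  map suc (upTo (suc (K + K)))                              ∎
  where
  open PermutationReasoning
  length-π : length π ≡ K
  length-π = IsPerm⇒length π↭

zigzag-tail : ∀ d ps → All (1 ≤_) ps → All (λ z → z < suc (length ps) ⊎ d < z) (drop 1 (zigzag d ps))
zigzag-tail d []       _            = []
zigzag-tail d (q ∷ qs) (1≤q ∷ 1≤qs) = inj₂ (m<m+n d 1≤q) ∷
  subst (All _) (sym (zigzag-head d qs)) (inj₁ ≤-refl ∷ All.map (Sum.map₁ (m<n⇒m<1+n)) (zigzag-tail d qs 1≤qs))

zigzag-split : ∀ d ps {j} → All (1 ≤_) ps → 1 ≤ j → j ≤ length ps →
  Σ[ A ∈ List ℕ ] Σ[ y ∈ ℕ ] Σ[ Bs ∈ List ℕ ]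
    zigzag d ps ≡ A ++ y ∷ j ∷ Bs × d < y × All (λ z → z < j ⊎ d < z) Bs
zigzag-split d []       _            1≤j j≤0 = ⊥-elim (<⇒≱ 1≤j j≤0)
zigzag-split d (p ∷ ps) {j} (1≤p ∷ 1≤ps) 1≤j j≤ with m≤n⇒m<n∨m≡n j≤
... | inj₂ refl = [ suc j ] , d + p , drop 1 (zigzag d ps) ,
                  cong (λ w → suc j ∷ d + p ∷ w) (zigzag-head d ps) , m<m+n d 1≤p , zigzag-tail d ps 1≤ps
... | inj₁ j<   = let A , y , Bs , zigzag≡ , d<y , bounds = zigzag-split d ps 1≤ps 1≤j (≤-pred j<) in
                  suc (suc (length ps)) ∷ d + p ∷ A , y , Bs , cong (λ w → _ ∷ _ ∷ w) zigzag≡ , d<y , bounds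

zigzag-large : ∀ d ps → All (1 ≤_) ps → length ps < d → atLeast (suc d) (zigzag d ps) ≡ map (d +_) ps
zigzag-large d []       _            0<d = filter-reject (suc d ≤?_) (<⇒≱ (s≤s 0<d))
zigzag-large d (p ∷ ps) (1≤p ∷ 1≤ps) l<d = begin
  atLeast (suc d) (suc (suc (length ps)) ∷ d + p ∷ zigzag d ps) ≡⟨ filter-reject (suc d ≤?_) (<⇒≱ (s≤s l<d)) ⟩
  atLeast (suc d) (d + p ∷ zigzag d ps)                        ≡⟨ filter-accept (suc d ≤?_) (m<m+n d 1≤p) ⟩
  d + p ∷ atLeast (suc d) (zigzag d ps)                        ≡⟨ cong (d + p ∷_) (zigzag-large d ps 1≤ps (<-trans (n<1+n _) l<d)) ⟩
  d + p ∷ map (d +_) ps                                        ∎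
  where open ≡-Reasoning

module Zigzag {K π} (1≤K : 1 ≤ K) (π↭ : IsPerm K π) where
  open Reduction 1≤K (zigzag-perm π↭)

  private
    module π = PermOf (permOf π↭)
    length-π : length π ≡ K
    length-π = IsPerm⇒length π↭

  zigzag-rigid : AllRigid
  zigzag-rigid {j} 1≤j j≤K with zigzag-split (suc K) π π.positive 1≤j (subst (j ≤_) (sym length-π) j≤K)
  ... | A , y , Bs , zigzag≡ , 1+K<y , bounds =
    trans (cong (λ w → proj₂ (pass w j)) rest≡) (pass-stops-after⁺ (atLeast j A) y (atLeast j Bs) j j∉ y≢j y≢sj sj∉)
    where
    open ≡-Reasoning
    j<y : j < y
    j<y = ≤-<-trans j≤K (<-trans (n<1+n K) 1+K<y)
    rest≡ : rest j ≡ atLeast j A ++ y ∷ j ∷ atLeast j Bs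
    rest≡ = begin
      atLeast j (zigzag (suc K) π)          ≡⟨ cong (atLeast j) zigzag≡ ⟩
      atLeast j (A ++ y ∷ j ∷ Bs)           ≡⟨ filter-++ (j ≤?_) A (y ∷ j ∷ Bs) ⟩
      atLeast j A ++ atLeast j (y ∷ j ∷ Bs) ≡⟨ cong (atLeast j A ++_) (trans (filter-accept (j ≤?_) (<⇒≤ j<y))
                                                 (cong (y ∷_) (filter-accept (j ≤?_) ≤-refl))) ⟩
      atLeast j A ++ y ∷ j ∷ atLeast j Bs   ∎
    j∉ : j ∉ atLeast j A
    j∉ j∈ = Unique-++-disjoint A (subst Unique zigzag≡ (PermOf.unique (permOf (zigzag-perm π↭))))
              (proj₁ (∈-filter⁻ (j ≤?_) j∈)) (there (here refl))
    y≢j : y ≢ j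
    y≢j refl = <-irrefl refl j<y
    y≢sj : y ≢ suc j
    y≢sj refl = <⇒≱ 1+K<y (s≤s j≤K)
    sj∉ : suc j ∉ atLeast j Bs
    sj∉ sj∈ with All.lookup bounds (proj₁ (∈-filter⁻ (j ≤?_) sj∈))
    ... | inj₁ sj<j = <-asym sj<j (n<1+n j)
    ... | inj₂ 1+K<1+j = <⇒≱ 1+K<1+j (s≤s j≤K)

  standardized≡π : standardized ≡ π
  standardized≡π = trans (cong (map (_∸ suc K)) (zigzag-large (suc K) π π.positive (s≤s (≤-reflexive length-π))))
                         (map-∸-+ (suc K) π)

  tier-zigzag : tier (zigzag (suc K) π) ≡ K + tier π
  tier-zigzag = trans (tier-rigid zigzag-rigid) (cong (λ π′ → K + tier π′) standardized≡π)

lemma3p6 : (k : ℕ) → (b : ℕ) → IsMaxTier (suc k) b →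
    IsMaxTier (suc (2 * suc k)) (suc k + b)
lemma3p6 k b ((π , π↭ , tier-π) , tier≤b) =
  subst (λ n → IsMaxTier n (K + b)) (cong (suc ∘ (K +_)) (sym (+-identityʳ K)))
        ((zigzag (suc K) π , zigzag-perm π↭ , attained) , bounded)
  where
  K : ℕ
  K = suc k
  attained : tier (zigzag (suc K) π) ≡ K + b
  attained = trans (Zigzag.tier-zigzag (s≤s z≤n) π↭) (cong (K +_) tier-π)
  bounded : ∀ σ → IsPerm (suc (K + K)) σ → tier σ ≤ K + b
  bounded σ σ↭ = ≤-trans (Reduction.tier-upper (s≤s z≤n) σ↭)
                         (+-monoʳ-≤ K (tier≤b _ (Reduction.standardized-perm (s≤s z≤n) σ↭)))
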